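{- For every $\sf SCI$-formula $\varphi$, if $\varphi$ has a $\mathsf{TC}_{\mathsf{SCI}}$-tableau proof, then $\varphi$ has a $\mathsf{TC}_{\mathsf{SCI}}+({\sf UB})$-tableau proof.
   Context: $\mathsf{SCI}$ (Sentential Calculus with Identity) has formulas built from a denumerable set of atoms by $\neg$, $\to$ and the identity connective $\equiv$. An $\mathsf{SCI}$-model is $\langle U,D,\tilde\neg,\tilde\to,\tilde\equiv\rangle$ with $\emptyset\neq D\subset U$ and operations on $U$ such that $\tilde\neg a\in D$ iff $a\notin D$; $a\tilde\to b\in D$ iff $a\notin D$ or $b\in D$; $a\tilde\equiv b\in D$ iff $a=b$. The labelled tableau system $\mathsf{TC}_{\mathsf{SCI}}$ uses labels from disjoint countably infinite sets $\mathsf L^+$ (denoting designated elements) and $\mathsf L^-$ (non-designated elements); nodes carry labelled formulas $w:\varphi$, equalities $w=v$ and inequalities $w\neq v$ between labels. Decomposition rules (all labels in conclusions fresh on the branch): $(\neg^+)$ $w^+:\neg\varphi\,/\,v^-:\varphi$; $(\neg^-)$ $w^-:\neg\varphi\,/\,v^+:\varphi$; $(\to^+)$ $w^+:\varphi\to\psi$ branches into $\{v^-:\varphi,u^-:\psi\}\mid\{v^-:\varphi,u^+:\psi\}\mid\{v^+:\varphi,u^+:\psi\}$; $(\to^-)$ $w^-:\varphi\to\psi\,/\,v^+:\varphi,u^-:\psi$; $(\equiv^+)$ $w^+:\varphi\equiv\psi$ branches into $\{v^+:\varphi,u^+:\psi,v^+=u^+\}\mid\{v^-:\varphi,u^-:\psi,v^-=u^-\}$;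 $(\equiv^-)$ $w^-:\varphi\equiv\psi$ branches into $\{v^+:\varphi,u^+:\psi,v^+\neq u^+\}\mid\{v^+:\varphi,u^-:\psi\}\mid\{v^-:\varphi,u^+:\psi\}\mid\{v^-:\varphi,u^-:\psi,v^-\neq u^-\}$. Equality rules (writing $\varphi\approx\psi$ for the three premises $w:\varphi$, $v:\psi$, $w=v$ for some labels $w,v$): $(\equiv^\neg)$ from $\varphi\approx\psi$, $u:\neg\varphi$, $y:\neg\psi$ infer $u=y$; $(\equiv^\to)$ from $\varphi\approx\psi$, $\chi\approx\theta$, $x:\varphi\to\chi$, $z:\psi\to\theta$ infer $x=z$; $(\equiv^\equiv)$ likewise with $\equiv$ in place of $\to$; $(\mathsf F)$ from $w:\varphi$, $v:\varphi$ infer $w=v$; $(\mathsf{sym})$ and $(\mathsf{tran})$ for $=$. Closure rules: $(\bot_1)$ from $w=v$ and $w\neq v$ infer $\bot$; $(\bot_2)$ from $w^+=v^-$ infer $\bot$ (applied eagerly). A decomposition rule is applied to a given premise at most once on a branch; an equality rule is applied only if its conclusion is not already on the branch. A branch is closed if a closure rule was applied to it; a tableau is closed if all its branches are closed. A tableau proof of $\varphi$ is a closed tableau with $w^-:\varphi$ at the root. For a subformula $\psi$, the first occurrence of a labelled formula $w:\psi$ on a branch $\mathcal B$ is the $\psi$-urfather on $\mathcal B$. $\mathsf{TC}_{\mathsf{SCI}}+({\sf UB})$ consists of the rules of $\mathsf{TC}_{\mathsf{SCI}}$ plus the constraint (UB): no decomposition rule may be applied to a labelled formula $w:\psi$ on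 $\mathcal B$ unless it is the $\psi$-urfather on $\mathcal B$. -}

module Defs where

open import Data.Nat using (ℕ)
open import Data.Bool using (Bool; true; false)
open import Data.List using (List; []; _∷_; _++_; [_]; concatMap)
open import Data.List.Membership.Propositional using (_∈_; _∉_)
open import Data.Product using (Σ; ∃; ∃-syntax; _×_; _,_)
open import Data.Unit using (⊤)
open import Relation.Binary.PropositionalEquality using (_≡_; _≢_)

data Fm : Set where
  atom : ℕ → Fm
  ¬′_  : Fm → Fm
  _⇒_  : Fm → Fm → Fm
  _≐_  : Fm → Fm → Fm

infixr 6 ¬′_
infixr 4 _⇒_
infix  5 _≐_

data Label : Set where
  L⁺ : ℕ → Label   -- labels denoting designated elements
  L⁻ : ℕ → Label   -- labels denoting non-designated elements

data Node : Set where
  lf  : Label → Fm → Node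
  eq  : Label → Label → Node
  neq : Label → Label → Node

-- A branch, in chronological order (older nodes first; new nodes are
-- appended at the end).
Branch : Set
Branch = List Node

labelsOf : Node → List Label
labelsOf (lf w _)  = w ∷ []
labelsOf (eq w v)  = w ∷ v ∷ []
labelsOf (neq w v) = w ∷ v ∷ []

Fresh : Branch → Label → Set
Fresh B l = l ∉ concatMap labelsOf B

Fresh₂ : Branch → Label → Label → Set
Fresh₂ B a b = Fresh B a × Fresh B b × a ≢ b

Approx : Branch → Fm → Fm → Set
Approx B φ ψ = ∃[ w ] ∃[ v ] (lf w φ ∈ B × lf v ψ ∈ B × eq w v ∈ B)

Urfather : Branch → Label → Fm → Set
Urfather B w ψ =
  ∃[ D ] ∃[ E ] (B ≡ D ++ lf w ψ ∷ E × (∀ v → lf v ψ ∉ D))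

-- Decomp B w φ CS: the rule for premise w:φ on
-- branch B, producing the list CS of conclusion sets (one per new branch),
-- with all conclusion labels fresh on B (and pairwise distinct within a
-- conclusion set).
data Decomp (B : Branch) : Label → Fm → List (List Node) → Set where
  d¬⁺ : ∀ {n i φ} → Fresh B (L⁻ i) →
        Decomp B (L⁺ n) (¬′ φ) ((lf (L⁻ i) φ ∷ []) ∷ [])
  d¬⁻ : ∀ {n i φ} → Fresh B (L⁺ i) →
        Decomp B (L⁻ n) (¬′ φ) ((lf (L⁺ i) φ ∷ []) ∷ [])
  d⇒⁺ : ∀ {n i₁ j₁ i₂ j₂ i₃ j₃ φ ψ} →
        Fresh₂ B (L⁻ i₁) (L⁻ j₁) → Fresh₂ B (L⁻ i₂) (L⁺ j₂) →
        Fresh₂ B (L⁺ i₃) (L⁺ j₃) →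
        Decomp B (L⁺ n) (φ ⇒ ψ)
          ((lf (L⁻ i₁) φ ∷ lf (L⁻ j₁) ψ ∷ [])
           ∷ (lf (L⁻ i₂) φ ∷ lf (L⁺ j₂) ψ ∷ [])
           ∷ (lf (L⁺ i₃) φ ∷ lf (L⁺ j₃) ψ ∷ []) ∷ [])
  d⇒⁻ : ∀ {n i j φ ψ} → Fresh₂ B (L⁺ i) (L⁻ j) →
        Decomp B (L⁻ n) (φ ⇒ ψ) ((lf (L⁺ i) φ ∷ lf (L⁻ j) ψ ∷ []) ∷ [])
  d≐⁺ : ∀ {n i₁ j₁ i₂ j₂ φ ψ} →
        Fresh₂ B (L⁺ i₁) (L⁺ j₁) → Fresh₂ B (L⁻ i₂) (L⁻ j₂) →
        Decomp B (L⁺ n) (φ ≐ ψ)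
          ((lf (L⁺ i₁) φ ∷ lf (L⁺ j₁) ψ ∷ eq (L⁺ i₁) (L⁺ j₁) ∷ [])
           ∷ (lf (L⁻ i₂) φ ∷ lf (L⁻ j₂) ψ ∷ eq (L⁻ i₂) (L⁻ j₂) ∷ []) ∷ [])
  d≐⁻ : ∀ {n i₁ j₁ i₂ j₂ i₃ j₃ i₄ j₄ φ ψ} →
        Fresh₂ B (L⁺ i₁) (L⁺ j₁) → Fresh₂ B (L⁺ i₂) (L⁻ j₂) →
        Fresh₂ B (L⁻ i₃) (L⁺ j₃) → Fresh₂ B (L⁻ i₄) (L⁻ j₄) →
        Decomp B (L⁻ n) (φ ≐ ψ)
          ((lf (L⁺ i₁) φ ∷ lf (L⁺ j₁) ψ ∷ neq (L⁺ i₁) (L⁺ j₁) ∷ [])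
           ∷ (lf (L⁺ i₂) φ ∷ lf (L⁻ j₂) ψ ∷ [])
           ∷ (lf (L⁻ i₃) φ ∷ lf (L⁺ j₃) ψ ∷ [])
           ∷ (lf (L⁻ i₄) φ ∷ lf (L⁻ j₄) ψ ∷ neq (L⁻ i₄) (L⁻ j₄) ∷ []) ∷ [])

data EqRule (B : Branch) : Label → Label → Set where
  r¬   : ∀ {a b φ ψ} → Approx B φ ψ →
         lf a (¬′ φ) ∈ B → lf b (¬′ ψ) ∈ B → EqRule B a b
  r⇒   : ∀ {a b φ ψ χ θ} → Approx B φ ψ → Approx B χ θ →
         lf a (φ ⇒ χ) ∈ B → lf b (ψ ⇒ θ) ∈ B → EqRule B a b
  r≐   : ∀ {a b φ ψ χ θ} → Approx B φ ψ → Approx B χ θ →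
         lf a (φ ≐ χ) ∈ B → lf b (ψ ≐ θ) ∈ B → EqRule B a b
  rF   : ∀ {a b φ} → lf a φ ∈ B → lf b φ ∈ B → EqRule B a b
  rsym : ∀ {a b} → eq b a ∈ B → EqRule B a b
  rtran : ∀ {a b c} → eq a c ∈ B → eq c b ∈ B → EqRule B a b

-- No equality w⁺ = v⁻ on the branch (used to enforce eager application
-- of (⊥₂): no other rule may be applied while (⊥₂) is applicable).
NoMixed : Branch → Set
NoMixed B = ∀ i j → eq (L⁺ i) (L⁻ j) ∉ B

Allowed : Bool → Branch → Label → Fm → Set
Allowed false B w φ = ⊤
Allowed true  B w φ = Urfather B w φ

-- Closed ub B U : there is a closed tableau extending branch B, where U
-- lists the premises already decomposed on B.  ub = false gives TC_SCI,
-- ub = true gives TC_SCI + (UB).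
data Closed (ub : Bool) : Branch → List Node → Set where
  close₁ : ∀ {B U a b} → eq a b ∈ B → neq a b ∈ B → Closed ub B U
  close₂ : ∀ {B U i j} → eq (L⁺ i) (L⁻ j) ∈ B → Closed ub B U
  decomp : ∀ {B U w φ} (CS : List (List Node)) →
           NoMixed B →
           lf w φ ∈ B →
           lf w φ ∉ U →              -- at most once per premise on a branch
           Allowed ub B w φ →
           Decomp B w φ CS →
           (∀ C → C ∈ CS → Closed ub (B ++ C) (lf w φ ∷ U)) →
           Closed ub B U
  equal  : ∀ {B U a b} →
           NoMixed B →
           EqRule B a b →
           eq a b ∉ B →
           Closed ub (B ++ eq a b ∷ []) U →
           Closed ub B U

TableauProof : Bool → Fm → Set
TableauProof ub φ = ∃[ n ] Closed ub (lf (L⁻ n) φ ∷ []) []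

TC-Provable : Fm → Set
TC-Provable = TableauProof false

TCUB-Provable : Fm → Set
TCUB-Provable = TableauProof true

-- A closed TC_SCI tableau is replayed inside a TC_SCI + (UB) tableau along
-- a sign-preserving relabelling f.  The equality and closure rules only look
-- at the shape of nodes, so they survive relabelling.  A decomposition of w:φ
-- is replayed on the φ-urfather u:φ of the new branch instead.  If u and f w
-- have opposite signs, (F) yields an equality w⁺ = v⁻ and (⊥₂) closes.  If u:φ
-- was already decomposed, one of its conclusion sets is already on the branch
-- and we follow the original tableau into the matching branch; otherwise we
-- decompose u:φ now.  In both cases f is extended by sending the fresh labels
-- of the original conclusion set to those of the replayed one.

module Submission where

open import Defs
open import Data.Bool using (true; false)
open import Data.Empty using (⊥-elim)
open import Data.List using (List; []; _∷_; _++_; map; concatMap)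
open import Data.List.Extrema.Nat using (max; xs≤max)
open import Data.List.Membership.Propositional using (_∈_; find; lose)
open import Data.List.Membership.Propositional.Properties
  using (∈-++⁺ˡ; ∈-++⁺ʳ; ∈-++⁻; ∈-map⁺; ∈-concat⁺′)
open import Data.List.Relation.Binary.Subset.Propositional using (_⊆_)
open import Data.List.Relation.Unary.All as All using ()
open import Data.List.Relation.Unary.Any as Any using (Any; here; there; any?)
open import Data.Nat using (ℕ; suc; _≤_; _<_; _≟_)
open import Data.Nat.Properties using (≤-refl; ≤-trans; <⇒≤; <-irrefl; ≤⇒≯)
open import Data.Product using (∃-syntax; _×_; _,_)
open import Data.Sum using (_⊎_; inj₁; inj₂)
open import Relation.Nullary using (Dec; yes; no; ¬_)
open import Relation.Nullary.Decidable using (map′; _×-dec_)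
open import Relation.Binary.PropositionalEquality
  using (_≡_; _≢_; refl; sym; trans; cong; cong₂; subst)

infix 4 _≟ᴸ_ _≟ᶠ_ _≟ᴺ_

_≟ᴸ_ : (a b : Label) → Dec (a ≡ b)
L⁺ i ≟ᴸ L⁺ j = map′ (cong L⁺) (λ { refl → refl }) (i ≟ j)
L⁻ i ≟ᴸ L⁻ j = map′ (cong L⁻) (λ { refl → refl }) (i ≟ j)
L⁺ _ ≟ᴸ L⁻ _ = no λ ()
L⁻ _ ≟ᴸ L⁺ _ = no λ ()

_≟ᶠ_ : (φ ψ : Fm) → Dec (φ ≡ ψ)
atom i ≟ᶠ atom j = map′ (cong atom) (λ { refl → refl }) (i ≟ j)
¬′ φ ≟ᶠ ¬′ ψ = map′ (cong ¬′_) (λ { refl → refl }) (φ ≟ᶠ ψ)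
(φ ⇒ χ) ≟ᶠ (ψ ⇒ θ) =
  map′ (λ (p , q) → cong₂ _⇒_ p q) (λ { refl → refl , refl }) (φ ≟ᶠ ψ ×-dec χ ≟ᶠ θ)
(φ ≐ χ) ≟ᶠ (ψ ≐ θ) =
  map′ (λ (p , q) → cong₂ _≐_ p q) (λ { refl → refl , refl }) (φ ≟ᶠ ψ ×-dec χ ≟ᶠ θ)
atom _ ≟ᶠ ¬′ _ = no λ ()
atom _ ≟ᶠ (_ ⇒ _) = no λ ()
atom _ ≟ᶠ (_ ≐ _) = no λ ()
¬′ _ ≟ᶠ atom _ = no λ ()
¬′ _ ≟ᶠ (_ ⇒ _) = no λ ()
¬′ _ ≟ᶠ (_ ≐ _) = no λ ()
(_ ⇒ _) ≟ᶠ atom _ = no λ ()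
(_ ⇒ _) ≟ᶠ ¬′ _ = no λ ()
(_ ⇒ _) ≟ᶠ (_ ≐ _) = no λ ()
(_ ≐ _) ≟ᶠ atom _ = no λ ()
(_ ≐ _) ≟ᶠ ¬′ _ = no λ ()
(_ ≐ _) ≟ᶠ (_ ⇒ _) = no λ ()

_≟ᴺ_ : (x y : Node) → Dec (x ≡ y)
lf a φ ≟ᴺ lf b ψ =
  map′ (λ (p , q) → cong₂ lf p q) (λ { refl → refl , refl }) (a ≟ᴸ b ×-dec φ ≟ᶠ ψ)
eq a b ≟ᴺ eq c d =
  map′ (λ (p , q) → cong₂ eq p q) (λ { refl → refl , refl }) (a ≟ᴸ c ×-dec b ≟ᴸ d)
neq a b ≟ᴺ neq c d =
  map′ (λ (p , q) → cong₂ neq p q) (λ { refl → refl , refl }) (a ≟ᴸ c ×-dec b ≟ᴸ d)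
lf _ _ ≟ᴺ eq _ _ = no λ ()
lf _ _ ≟ᴺ neq _ _ = no λ ()
eq _ _ ≟ᴺ lf _ _ = no λ ()
eq _ _ ≟ᴺ neq _ _ = no λ ()
neq _ _ ≟ᴺ lf _ _ = no λ ()
neq _ _ ≟ᴺ eq _ _ = no λ ()

open import Data.List.Membership.DecPropositional _≟ᴺ_ using (_∈?_)

data MixedEq : Node → Set where
  mixedEq : ∀ {i j} → MixedEq (eq (L⁺ i) (L⁻ j))

mixedEq? : (x : Node) → Dec (MixedEq x)
mixedEq? (eq (L⁺ _) (L⁻ _)) = yes mixedEq
mixedEq? (eq (L⁺ _) (L⁺ _)) = no λ ()
mixedEq? (eq (L⁻ _) _) = no λ ()
mixedEq? (lf _ _) = no λ ()
mixedEq? (neq _ _) = no λ ()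

close₂-any : ∀ {ub B U} → Any MixedEq B → Closed ub B U
close₂-any m with find m
... | _ , e∈B , mixedEq = close₂ e∈B

close₂-eagerly : ∀ {ub B U} → (NoMixed B → Closed ub B U) → Closed ub B U
close₂-eagerly {B = B} k with any? mixedEq? B
... | yes m = close₂-any m
... | no ¬m = k λ _ _ e∈B → ¬m (lose e∈B mixedEq)

idx : Label → ℕ
idx (L⁺ i) = i
idx (L⁻ i) = i

labelsOn : Branch → List Label
labelsOn B = concatMap labelsOf B

bound : Branch → ℕ
bound B = suc (max 0 (map idx (labelsOn B)))

label∈labelsOn : ∀ {x l B} → x ∈ B → l ∈ labelsOf x → l ∈ labelsOn B
label∈labelsOn x∈B l∈x = ∈-concat⁺′ l∈x (∈-map⁺ labelsOf x∈B)

fresh-above : ∀ B {l} → bound B ≤ idx l → Fresh B l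
fresh-above B bound≤l l∈B = ≤⇒≯ (All.lookup (xs≤max 0 _) (∈-map⁺ idx l∈B)) bound≤l

fresh₂-above : ∀ B {a b} → bound B ≤ idx a → idx a < idx b → Fresh₂ B a b
fresh₂-above B bound≤a a<b =
  fresh-above B bound≤a , fresh-above B (≤-trans bound≤a (<⇒≤ a<b)) ,
  λ { refl → <-irrefl refl a<b }

data SameSign : Label → Label → Set where
  both⁺ : ∀ {i j} → SameSign (L⁺ i) (L⁺ j)
  both⁻ : ∀ {i j} → SameSign (L⁻ i) (L⁻ j)

data Opposite : Label → Label → Set where
  opp⁺⁻ : ∀ {i j} → Opposite (L⁺ i) (L⁻ j)
  opp⁻⁺ : ∀ {i j} → Opposite (L⁻ i) (L⁺ j)

sign? : ∀ a b → SameSign a b ⊎ Opposite a b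
sign? (L⁺ _) (L⁺ _) = inj₁ both⁺
sign? (L⁻ _) (L⁻ _) = inj₁ both⁻
sign? (L⁺ _) (L⁻ _) = inj₂ opp⁺⁻
sign? (L⁻ _) (L⁺ _) = inj₂ opp⁻⁺

SameSign-trans : ∀ {a b c} → SameSign a b → SameSign b c → SameSign a c
SameSign-trans both⁺ both⁺ = both⁺
SameSign-trans both⁻ both⁻ = both⁻

decompose-like : ∀ {B w u φ CS} → Decomp B w φ CS → SameSign w u →
                 (B' : Branch) → ∃[ CS' ] Decomp B' u φ CS'
decompose-like (d¬⁺ _) both⁺ B' = _ , d¬⁺ (fresh-above B' ≤-refl)
decompose-like (d¬⁻ _) both⁻ B' = _ , d¬⁻ (fresh-above B' ≤-refl)
decompose-like (d⇒⁺ _ _ _) both⁺ B' =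
  _ , d⇒⁺ (fresh₂-above B' ≤-refl ≤-refl) (fresh₂-above B' ≤-refl ≤-refl)
          (fresh₂-above B' ≤-refl ≤-refl)
decompose-like (d⇒⁻ _) both⁻ B' = _ , d⇒⁻ (fresh₂-above B' ≤-refl ≤-refl)
decompose-like (d≐⁺ _ _) both⁺ B' =
  _ , d≐⁺ (fresh₂-above B' ≤-refl ≤-refl) (fresh₂-above B' ≤-refl ≤-refl)
decompose-like (d≐⁻ _ _ _ _) both⁻ B' =
  _ , d≐⁻ (fresh₂-above B' ≤-refl ≤-refl) (fresh₂-above B' ≤-refl ≤-refl)
          (fresh₂-above B' ≤-refl ≤-refl) (fresh₂-above B' ≤-refl ≤-refl)

-- Separate index maps on L⁺ and L⁻ make relabellings sign-preserving by construction.
record Renaming : Set where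
  constructor mkRenaming
  field
    on⁺ on⁻ : ℕ → ℕ
open Renaming

identity : Renaming
identity = mkRenaming (λ i → i) (λ i → i)

rename : Renaming → Label → Label
rename f (L⁺ i) = L⁺ (on⁺ f i)
rename f (L⁻ i) = L⁻ (on⁻ f i)

renameNode : Renaming → Node → Node
renameNode f (lf w φ) = lf (rename f w) φ
renameNode f (eq a b) = eq (rename f a) (rename f b)
renameNode f (neq a b) = neq (rename f a) (rename f b)

SameSign-rename : ∀ f w → SameSign w (rename f w)
SameSign-rename f (L⁺ _) = both⁺
SameSign-rename f (L⁻ _) = both⁻

_[_≔_] : (ℕ → ℕ) → ℕ → ℕ → ℕ → ℕ
(g [ i ≔ v ]) k with k ≟ i
... | yes _ = v
... | no _ = g k

≔-hit : ∀ g i v → (g [ i ≔ v ]) i ≡ v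
≔-hit g i v with i ≟ i
... | yes _ = refl
... | no i≢i = ⊥-elim (i≢i refl)

≔-miss : ∀ g i v k → k ≢ i → (g [ i ≔ v ]) k ≡ g k
≔-miss g i v k k≢i with k ≟ i
... | yes k≡i = ⊥-elim (k≢i k≡i)
... | no _ = refl

update : Renaming → (a a' : Label) → SameSign a a' → Renaming
update f (L⁺ i) (L⁺ i') both⁺ = record f { on⁺ = on⁺ f [ i ≔ i' ] }
update f (L⁻ i) (L⁻ i') both⁻ = record f { on⁻ = on⁻ f [ i ≔ i' ] }

update-hit : ∀ f a a' s → rename (update f a a' s) a ≡ a'
update-hit f (L⁺ i) (L⁺ i') both⁺ = cong L⁺ (≔-hit (on⁺ f) i i')
update-hit f (L⁻ i) (L⁻ i') both⁻ = cong L⁻ (≔-hit (on⁻ f) i i')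

update-miss : ∀ f a a' s l → l ≢ a → rename (update f a a' s) l ≡ rename f l
update-miss f (L⁺ i) (L⁺ i') both⁺ (L⁺ k) k≢i =
  cong L⁺ (≔-miss (on⁺ f) i i' k λ { refl → k≢i refl })
update-miss f (L⁺ i) (L⁺ i') both⁺ (L⁻ k) _ = refl
update-miss f (L⁻ i) (L⁻ i') both⁻ (L⁺ k) _ = refl
update-miss f (L⁻ i) (L⁻ i') both⁻ (L⁻ k) k≢i =
  cong L⁻ (≔-miss (on⁻ f) i i' k λ { refl → k≢i refl })

renameNode-cong : ∀ f g x → (∀ {l} → l ∈ labelsOf x → rename g l ≡ rename f l) →
                  renameNode g x ≡ renameNode f x
renameNode-cong f g (lf w φ) g≗f = cong (λ v → lf v φ) (g≗f (here refl))
renameNode-cong f g (eq a b) g≗f = cong₂ eq (g≗f (here refl)) (g≗f (there (here refl)))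
renameNode-cong f g (neq a b) g≗f = cong₂ neq (g≗f (here refl)) (g≗f (there (here refl)))

Agree : Branch → Renaming → Renaming → Set
Agree B f g = ∀ {x} → x ∈ B → renameNode g x ≡ renameNode f x

Agree-trans : ∀ {B f g h} → Agree B f g → Agree B g h → Agree B f h
Agree-trans f≗g g≗h x∈B = trans (g≗h x∈B) (f≗g x∈B)

update-agrees : ∀ {B a} f a' s → Fresh B a → Agree B f (update f a a' s)
update-agrees {a = a} f a' s a-fresh {x} x∈B =
  renameNode-cong f (update f a a' s) x λ l∈x →
    update-miss f a a' s _ λ { refl → a-fresh (label∈labelsOn x∈B l∈x) }

extend₂ : ∀ {B a b a' b'} f → Fresh₂ B a b → SameSign a a' → SameSign b b' →
          ∃[ g ] (Agree B f g × rename g a ≡ a' × rename g b ≡ b')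
extend₂ {a = a} {b} {a'} {b'} f (a-fresh , b-fresh , a≢b) s t =
  g , Agree-trans (update-agrees f a' s a-fresh) (update-agrees f₁ b' t b-fresh) ,
  trans (update-miss f₁ b b' t a a≢b) (update-hit f a a' s) , update-hit f₁ b b' t
  where
  f₁ = update f a a' s
  g = update f₁ b b' t

Corresponds : Branch → Renaming → List Node → List Node → Set
Corresponds B f C C' = ∃[ g ] (Agree B f g × map (renameNode g) C ≡ C')

corresponds₁ : ∀ {B a a' φ} f → Fresh B a → SameSign a a' →
               Corresponds B f (lf a φ ∷ []) (lf a' φ ∷ [])
corresponds₁ {a = a} {a'} {φ} f a-fresh s =
  update f a a' s , update-agrees f a' s a-fresh ,
  cong (λ v → lf v φ ∷ []) (update-hit f a a' s)

corresponds₂ : ∀ {B a b a' b'} f (T : Label → Label → List Node) →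
               (∀ g → map (renameNode g) (T a b) ≡ T (rename g a) (rename g b)) →
               Fresh₂ B a b → SameSign a a' → SameSign b b' →
               Corresponds B f (T a b) (T a' b')
corresponds₂ f T natural fresh s t =
  let g , f≗g , ga , gb = extend₂ f fresh s t
  in g , f≗g , trans (natural g) (cong₂ T ga gb)

pairSet pairEqSet pairNeqSet : Fm → Fm → Label → Label → List Node
pairSet φ ψ a b = lf a φ ∷ lf b ψ ∷ []
pairEqSet φ ψ a b = lf a φ ∷ lf b ψ ∷ eq a b ∷ []
pairNeqSet φ ψ a b = lf a φ ∷ lf b ψ ∷ neq a b ∷ []

corresponding-conclusion :
  ∀ {B B₀ w u φ CS CS'} f → Decomp B w φ CS → Decomp B₀ u φ CS' → SameSign w u →
  ∀ {C'} → C' ∈ CS' → ∃[ C ] (C ∈ CS × Corresponds B f C C')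
corresponding-conclusion f (d¬⁺ a) (d¬⁺ _) both⁺ (here refl) =
  _ , here refl , corresponds₁ f a both⁻
corresponding-conclusion f (d¬⁻ a) (d¬⁻ _) both⁻ (here refl) =
  _ , here refl , corresponds₁ f a both⁺
corresponding-conclusion f (d⇒⁺ a _ _) (d⇒⁺ _ _ _) both⁺ (here refl) =
  _ , here refl , corresponds₂ f (pairSet _ _) (λ _ → refl) a both⁻ both⁻
corresponding-conclusion f (d⇒⁺ _ b _) (d⇒⁺ _ _ _) both⁺ (there (here refl)) =
  _ , there (here refl) , corresponds₂ f (pairSet _ _) (λ _ → refl) b both⁻ both⁺
corresponding-conclusion f (d⇒⁺ _ _ c) (d⇒⁺ _ _ _) both⁺ (there (there (here refl))) =
  _ , there (there (here refl)) , corresponds₂ f (pairSet _ _) (λ _ → refl) c both⁺ both⁺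
corresponding-conclusion f (d⇒⁻ a) (d⇒⁻ _) both⁻ (here refl) =
  _ , here refl , corresponds₂ f (pairSet _ _) (λ _ → refl) a both⁺ both⁻
corresponding-conclusion f (d≐⁺ a _) (d≐⁺ _ _) both⁺ (here refl) =
  _ , here refl , corresponds₂ f (pairEqSet _ _) (λ _ → refl) a both⁺ both⁺
corresponding-conclusion f (d≐⁺ _ b) (d≐⁺ _ _) both⁺ (there (here refl)) =
  _ , there (here refl) , corresponds₂ f (pairEqSet _ _) (λ _ → refl) b both⁻ both⁻
corresponding-conclusion f (d≐⁻ a _ _ _) (d≐⁻ _ _ _ _) both⁻ (here refl) =
  _ , here refl , corresponds₂ f (pairNeqSet _ _) (λ _ → refl) a both⁺ both⁺
corresponding-conclusion f (d≐⁻ _ b _ _) (d≐⁻ _ _ _ _) both⁻ (there (here refl)) =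
  _ , there (here refl) , corresponds₂ f (pairSet _ _) (λ _ → refl) b both⁺ both⁻
corresponding-conclusion f (d≐⁻ _ _ c _) (d≐⁻ _ _ _ _) both⁻ (there (there (here refl))) =
  _ , there (there (here refl)) , corresponds₂ f (pairSet _ _) (λ _ → refl) c both⁻ both⁺
corresponding-conclusion f (d≐⁻ _ _ _ d) (d≐⁻ _ _ _ _) both⁻
  (there (there (there (here refl)))) =
  _ , there (there (there (here refl))) ,
  corresponds₂ f (pairNeqSet _ _) (λ _ → refl) d both⁻ both⁻

labelledBy? : ∀ φ x → Dec (∃[ u ] x ≡ lf u φ)
labelledBy? φ (lf u ψ) = map′ (λ { refl → u , refl }) (λ { (_ , refl) → refl }) (ψ ≟ᶠ φ)
labelledBy? φ (eq _ _) = no λ { (_ , ()) }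
labelledBy? φ (neq _ _) = no λ { (_ , ()) }

Urfather-∷ : ∀ {x B u φ} → ¬ (∃[ v ] x ≡ lf v φ) → Urfather B u φ → Urfather (x ∷ B) u φ
Urfather-∷ {x} x≠φ (D , E , refl , D∌φ) =
  x ∷ D , E , refl , λ { v (here refl) → x≠φ (v , refl) ; v (there p) → D∌φ v p }

urfather : ∀ B {v φ} → lf v φ ∈ B → ∃[ u ] Urfather B u φ
urfather (x ∷ B) {v} {φ} v∈ with labelledBy? φ x
... | yes (u , refl) = u , [] , B , refl , λ _ ()
... | no x≠φ =
  let u , u-urf = urfather B (Any.tail (λ e → x≠φ (v , sym e)) v∈)
  in u , Urfather-∷ x≠φ u-urf

Urfather⇒∈ : ∀ {B u φ} → Urfather B u φ → lf u φ ∈ B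
Urfather⇒∈ (D , _ , refl , _) = ∈-++⁺ʳ D (here refl)

Embeds : Renaming → Branch → Branch → Set
Embeds f B B' = ∀ {x} → x ∈ B → renameNode f x ∈ B'

Embeds-++ʳ : ∀ {f B B'} X → Embeds f B B' → Embeds f B (B' ++ X)
Embeds-++ʳ X emb x∈B = ∈-++⁺ˡ (emb x∈B)

Embeds-conclusion : ∀ {f g B B' C C'} → Embeds f B B' → Agree B f g →
                    map (renameNode g) C ≡ C' → C' ⊆ B' → Embeds g (B ++ C) B'
Embeds-conclusion {B = B} emb f≗g refl C'⊆B' x∈ with ∈-++⁻ B x∈
... | inj₁ x∈B = subst (_∈ _) (sym (f≗g x∈B)) (emb x∈B)
... | inj₂ x∈C = C'⊆B' (∈-map⁺ _ x∈C)

Embeds-snoc : ∀ {f B B' x} → Embeds f B B' → renameNode f x ∈ B' → Embeds f (B ++ x ∷ []) B'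
Embeds-snoc {B = B} emb fx∈ y∈ with ∈-++⁻ B y∈
... | inj₁ y∈B = emb y∈B
... | inj₂ (here refl) = fx∈

Approx-rename : ∀ {B B' φ ψ} f → Embeds f B B' → Approx B φ ψ → Approx B' φ ψ
Approx-rename f emb (w , v , p , q , r) = rename f w , rename f v , emb p , emb q , emb r

EqRule-rename : ∀ {B B' a b} f → Embeds f B B' → EqRule B a b →
                EqRule B' (rename f a) (rename f b)
EqRule-rename f emb (r¬ φ≈ψ p q) = r¬ (Approx-rename f emb φ≈ψ) (emb p) (emb q)
EqRule-rename f emb (r⇒ φ≈ψ χ≈θ p q) =
  r⇒ (Approx-rename f emb φ≈ψ) (Approx-rename f emb χ≈θ) (emb p) (emb q)
EqRule-rename f emb (r≐ φ≈ψ χ≈θ p q) =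
  r≐ (Approx-rename f emb φ≈ψ) (Approx-rename f emb χ≈θ) (emb p) (emb q)
EqRule-rename f emb (rF p q) = rF (emb p) (emb q)
EqRule-rename f emb (rsym p) = rsym (emb p)
EqRule-rename f emb (rtran p q) = rtran (emb p) (emb q)

Expanded : Branch → Label → Fm → Set
Expanded B' u φ = ∃[ B₀ ] ∃[ CS ] ∃[ C ] (Decomp B₀ u φ CS × C ∈ CS × C ⊆ B')

AllExpanded : Branch → List Node → Set
AllExpanded B' U = ∀ {u φ} → lf u φ ∈ U → Expanded B' u φ

AllExpanded-++ʳ : ∀ {B' U} X → AllExpanded B' U → AllExpanded (B' ++ X) U
AllExpanded-++ʳ X expanded p =
  let B₀ , CS , C , D , C∈ , C⊆ = expanded p in B₀ , CS , C , D , C∈ , λ x∈ → ∈-++⁺ˡ (C⊆ x∈)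

AllExpanded-∷ : ∀ {B' U B₀ u φ CS C} → Decomp B₀ u φ CS → C ∈ CS →
                AllExpanded B' U → AllExpanded (B' ++ C) (lf u φ ∷ U)
AllExpanded-∷ {B'} D C∈ _ (here refl) = _ , _ , _ , D , C∈ , ∈-++⁺ʳ B'
AllExpanded-∷ {C = C} _ _ expanded (there p) = AllExpanded-++ʳ C expanded p

close-opposite : ∀ {B U a b φ} → NoMixed B → Opposite a b →
                 lf a φ ∈ B → lf b φ ∈ B → Closed true B U
close-opposite {B} nm opp⁺⁻ p q = equal nm (rF p q) (nm _ _) (close₂ (∈-++⁺ʳ B (here refl)))
close-opposite {B} nm opp⁻⁺ p q = equal nm (rF q p) (nm _ _) (close₂ (∈-++⁺ʳ B (here refl)))

matching-branch : ∀ {B B₀ B' w u φ CS CS' C'} f → Decomp B w φ CS → Decomp B₀ u φ CS' →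
                  SameSign (rename f w) u → C' ∈ CS' → Embeds f B B' → C' ⊆ B' →
                  ∃[ C ] ∃[ g ] (C ∈ CS × Embeds g (B ++ C) B')
matching-branch {w = w} f D D' s C'∈ emb C'⊆B' =
  let C , C∈ , g , f≗g , gC≡C' =
        corresponding-conclusion f D D' (SameSign-trans (SameSign-rename f w) s) C'∈
  in C , g , C∈ , Embeds-conclusion emb f≗g gC≡C' C'⊆B'

simulate : ∀ {B U B' U'} f → Closed false B U → Embeds f B B' → AllExpanded B' U' →
           Closed true B' U'
simulate f (close₁ e n) emb _ = close₁ (emb e) (emb n)
simulate f (close₂ e) emb _ = close₂ (emb e)
simulate {B' = B'} f (equal {a = a} {b} _ r _ closed) emb expanded
  with eq (rename f a) (rename f b) ∈? B'
... | yes fe∈B' = simulate f closed (Embeds-snoc emb fe∈B') expanded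
... | no fe∉B' = close₂-eagerly λ nm →
  equal nm (EqRule-rename f emb r) fe∉B'
    (simulate f closed (Embeds-snoc (Embeds-++ʳ _ emb) (∈-++⁺ʳ B' (here refl)))
      (AllExpanded-++ʳ _ expanded))
simulate {B' = B'} {U'} f (decomp {B = B} {w = w} {φ} _ _ w∈B _ _ D closed) emb expanded =
  close₂-eagerly λ nm → replay nm (urfather B' (emb w∈B))
  where
  continue : ∀ {B₀ B'' U'' u CS' C'} → Decomp B₀ u φ CS' → SameSign (rename f w) u →
             C' ∈ CS' → Embeds f B B'' → C' ⊆ B'' → AllExpanded B'' U'' → Closed true B'' U''
  continue D' s C'∈ emb' C'⊆ expanded' =
    let C , g , C∈ , embC = matching-branch f D D' s C'∈ emb' C'⊆
    in simulate g (closed C C∈) embC expanded'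

  replay : NoMixed B' → ∃[ u ] Urfather B' u φ → Closed true B' U'
  replay nm (u , u-urf) with sign? (rename f w) u | lf u φ ∈? U'
  ... | inj₂ opp | _ = close-opposite nm opp (emb w∈B) (Urfather⇒∈ u-urf)
  ... | inj₁ s | yes u∈U' =
    let _ , _ , _ , D' , C'∈ , C'⊆B' = expanded u∈U' in continue D' s C'∈ emb C'⊆B' expanded
  ... | inj₁ s | no u∉U' =
    let CS' , D' = decompose-like D (SameSign-trans (SameSign-rename f w) s) B'
    in decomp CS' nm (Urfather⇒∈ u-urf) u∉U' u-urf D' λ C' C'∈ →
         continue D' s C'∈ (Embeds-++ʳ C' emb) (∈-++⁺ʳ B') (AllExpanded-∷ D' C'∈ expanded)

proposition13 : (φ : Fm) → TC-Provable φ → TCUB-Provable φ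
proposition13 φ (n , closed) =
  n , simulate identity closed (λ { (here refl) → here refl }) (λ ())
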